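{- Let $OPT^{(r)}_W$ be the minimum expected cost of a restricted strategy. Then \[OPT^{(r)}_W\le OPT_W+\frac{\epsilon T}{5}.\]
   Context: Fix integers $n\ge1$, $W\ge1$ and $\epsilon\in(0,1)$. There are $n$ item types; type $i$ has deterministic cost $c_i>0$ and random weight $X_i$ with known distribution supported in $\{1,\dots,W\}$ (standing assumption). Infinitely many items of each type, all weights independent; items are inserted one at a time with weights revealed upon insertion; a strategy adaptively chooses the next type and must continue until the total weight is at least $W$. $OPT_W$ is the minimum expected total cost over all strategies that stop as soon as total weight at least $W$ is reached. Let $\bar E[X_i]=\sum_{j=1}^W\Pr[X_i=j]2^{\lfloor\log_2j\rfloor}$, $T=\frac W2\min_i\frac{c_i}{\bar E[X_i]}$ and $\theta=\frac\epsilon{10n}$. For each type $p$: $e_p=1$ if $c_p\ge\theta T$; otherwise $e_p=2^{k_p}$ for an integer $k_p$ with $e_pc_p\in[\theta T,2\theta T]$. A restricted strategy is a strategy which stops only when the total weight is at least $W$ and, for every type $p$, the total number of items of type $p$ it has inserted is a multiple of $e_p$ (it may insert further items after the total weight has reached $W$ for this purpose).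
   Formalization: The costs $c_i$, the probabilities $\Pr[X_i=j]$, the parameter $\epsilon$ and the quantity $T$ are rational. -}

module Defs where

open import Data.Nat as ℕ using (ℕ; zero; suc; _^_)
open import Data.Nat.Logarithm using (⌊log₂_⌋)
open import Data.Nat.Divisibility using (_∣_)
open import Data.Fin using (Fin; toℕ; _≟_)
open import Data.Integer using (+_)
open import Data.Rational using (ℚ; 0ℚ; 1ℚ; _+_; _*_; _≤_; _<_; _/_)
open import Data.Product using (Σ; _×_)
open import Relation.Binary.PropositionalEquality using (_≡_)
open import Relation.Nullary using (¬_; yes; no)

ℕ→ℚ : ℕ → ℚ
ℕ→ℚ k = + k / 1

Σℚ : (k : ℕ) → (Fin k → ℚ) → ℚ
Σℚ zero    f = 0ℚ
Σℚ (suc k) f = f Fin.zero + Σℚ k (λ j → f (Fin.suc j))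

-- Weights are in {1,…,W}; index j : Fin W stands for weight (toℕ j + 1).
weight : {W : ℕ} → Fin W → ℕ
weight j = suc (toℕ j)

-- A probability distribution on {1,…,W}: P j = Pr[X = weight j].
IsDistribution : (W : ℕ) → (Fin W → ℚ) → Set
IsDistribution W P = ((j : Fin W) → 0ℚ ≤ P j) × (Σℚ W P ≡ 1ℚ)

Ebar : (W : ℕ) → (Fin W → ℚ) → ℚ
Ebar W P = Σℚ W (λ j → P j * ℕ→ℚ (2 ^ ⌊log₂ weight j ⌋))

-- T = (W/2) · min_i c_i / Ē[X_i], written out as the property of being that minimum
-- (all Ē[X_i] are positive for distributions on {1..W}).
IsT : (n W : ℕ) → (c : Fin n → ℚ) → (P : Fin n → Fin W → ℚ) → ℚ → Set
IsT n W c P T =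
  ((i : Fin n) → T * Ebar W (P i) ≤ (+ W / 2) * c i) ×
  Σ (Fin n) (λ i → T * Ebar W (P i) ≡ (+ W / 2) * c i)

-- θ = ε / (10 n)   (n ≥ 1; the value at n = 0 is irrelevant)
theta : ℚ → ℕ → ℚ
theta ε zero    = 0ℚ
theta ε (suc m) = ε * (+ 1 / (10 ℕ.* suc m))

IsE : (n : ℕ) → (c : Fin n → ℚ) → (θT : ℚ) → (Fin n → ℕ) → Set
IsE n c θT e = (p : Fin n) →
  (θT ≤ c p → e p ≡ 1) ×
  (c p < θT → Σ ℕ (λ k → (e p ≡ 2 ^ k) × (θT ≤ ℕ→ℚ (e p) * c p) × (ℕ→ℚ (e p) * c p ≤ ℕ→ℚ 2 * θT)))

-- Deterministic adaptive strategies as decision trees: either stop, or insert an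
-- item of type i and continue depending on its revealed weight.
data Strategy (n W : ℕ) : Set where
  stop : Strategy n W
  insert : Fin n → (Fin W → Strategy n W) → Strategy n W

cost : {n W : ℕ} → (c : Fin n → ℚ) → (P : Fin n → Fin W → ℚ) → Strategy n W → ℚ
cost c P stop         = 0ℚ
cost c P (insert i k) = c i + Σℚ _ (λ j → P i j * cost c P (k j))

data Valid {n W : ℕ} (w : ℕ) : Strategy n W → Set where
  stop-ok   : W ℕ.≤ w → Valid w stop
  insert-ok : ∀ {i k} → w ℕ.< W → ((j : Fin W) → Valid (w ℕ.+ weight j) (k j)) →
              Valid w (insert i k)

bump : {n : ℕ} → Fin n → (Fin n → ℕ) → Fin n → ℕ
bump i cnt p with p ≟ i
... | yes _ = suc (cnt p)
... | no  _ = cnt p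

data RValid {n W : ℕ} (e : Fin n → ℕ) (w : ℕ) (cnt : Fin n → ℕ) : Strategy n W → Set where
  stop-ok   : W ℕ.≤ w → ((p : Fin n) → e p ∣ cnt p) → RValid e w cnt stop
  insert-ok : ∀ {i k} → (W ℕ.≤ w → ¬ (e i ∣ cnt i)) →
              ((j : Fin W) → RValid e (w ℕ.+ weight j) (bump i cnt) (k j)) →
              RValid e w cnt (insert i k)

-- Run the given strategy S unchanged and, at each of its leaves, pad every type p
-- with the fewer than e_p items that round its count up to a multiple of e_p. The
-- result is restricted, and padding costs at most Σ_p (e_p - 1) c_p: zero for
-- e_p = 1, and below e_p c_p ≤ 2θT otherwise. Summed over the n types this is
-- 2nθT = εT/5, and since every leaf of S pays it at most once, so does the expectation.
module Submission where

open import Defs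
open import Data.Nat using (ℕ; suc; _≤_)
open import Data.Fin using (Fin)
open import Data.Integer using (+_)
open import Data.Rational using (ℚ; 0ℚ; 1ℚ; _+_; _*_; _<_; _/_) renaming (_≤_ to _≤ℚ_)
open import Data.Product using (Σ; _×_)

open import Data.Nat as ℕ using (zero; z≤n; s≤s)
import Data.Nat.Properties as ℕ
open import Data.Nat.Divisibility using (_∣_; _∣0; ∣-refl; ∣m∣n⇒∣m+n; ∣m+n∣m⇒∣n; ∣⇒≤)
open import Data.Nat.Logarithm using (⌊log₂_⌋)
open import Data.Fin as Fin using (_≟_)
import Data.Integer as ℤ
import Data.Integer.Properties as ℤ
open import Data.Integer.Solver using (module +-*-Solver)
import Data.Rational as ℚ
import Data.Rational.Properties as ℚ
open import Data.Rational.Solver renaming (module +-*-Solver to ℚ-Solver)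
import Data.Rational.Unnormalised as ℚᵘ
import Data.Rational.Unnormalised.Properties as ℚᵘ
open import Data.List using (List; []; _∷_; _++_; map; replicate)
open import Data.Product using (_,_; proj₁; proj₂)
open import Data.Sum using (inj₁; inj₂)
open import Function using (_∘_)
open import Relation.Nullary using (¬_; yes; no; contradiction)
open import Relation.Binary.PropositionalEquality

private
  fromℚᵘ-homo-+ : ∀ p q → ℚ.fromℚᵘ p + ℚ.fromℚᵘ q ≡ ℚ.fromℚᵘ (p ℚᵘ.+ q)
  fromℚᵘ-homo-+ p q = ℚ.toℚᵘ-injective
    (ℚᵘ.≃-trans (ℚ.toℚᵘ-homo-+ (ℚ.fromℚᵘ p) (ℚ.fromℚᵘ q))
      (ℚᵘ.≃-trans (ℚᵘ.+-cong (ℚ.toℚᵘ-fromℚᵘ p) (ℚ.toℚᵘ-fromℚᵘ q))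
        (ℚᵘ.≃-sym (ℚ.toℚᵘ-fromℚᵘ (p ℚᵘ.+ q)))))

  fromℚᵘ-homo-* : ∀ p q → ℚ.fromℚᵘ p * ℚ.fromℚᵘ q ≡ ℚ.fromℚᵘ (p ℚᵘ.* q)
  fromℚᵘ-homo-* p q = ℚ.toℚᵘ-injective
    (ℚᵘ.≃-trans (ℚ.toℚᵘ-homo-* (ℚ.fromℚᵘ p) (ℚ.fromℚᵘ q))
      (ℚᵘ.≃-trans (ℚᵘ.*-cong (ℚ.toℚᵘ-fromℚᵘ p) (ℚ.toℚᵘ-fromℚᵘ q))
        (ℚᵘ.≃-sym (ℚ.toℚᵘ-fromℚᵘ (p ℚᵘ.* q)))))

ℕ→ℚ-+ : ∀ a b → ℕ→ℚ (a ℕ.+ b) ≡ ℕ→ℚ a + ℕ→ℚ b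
ℕ→ℚ-+ a b = sym (trans (fromℚᵘ-homo-+ (ℚᵘ.mkℚᵘ (+ a) 0) (ℚᵘ.mkℚᵘ (+ b) 0))
  (ℚ.fromℚᵘ-cong {ℚᵘ.mkℚᵘ (+ a) 0 ℚᵘ.+ ℚᵘ.mkℚᵘ (+ b) 0} {ℚᵘ.mkℚᵘ (+ (a ℕ.+ b)) 0} (ℚᵘ.*≡* cross-multiplied)))
  where
  open +-*-Solver
  cross-multiplied : (+ a ℤ.* + 1 ℤ.+ + b ℤ.* + 1) ℤ.* + 1 ≡ + (a ℕ.+ b) ℤ.* (+ 1 ℤ.* + 1)
  cross-multiplied = trans
    (solve 2 (λ x y → (x :* con (+ 1) :+ y :* con (+ 1)) :* con (+ 1)
                    := (x :+ y) :* (con (+ 1) :* con (+ 1))) refl (+ a) (+ b))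
    (cong (ℤ._* (+ 1 ℤ.* + 1)) (sym (ℤ.pos-+ a b)))

n*1/[10n]≡1/10 : ∀ m → ℕ→ℚ (suc m) * (+ 1 / (10 ℕ.* suc m)) ≡ + 1 / 10
n*1/[10n]≡1/10 m = trans (fromℚᵘ-homo-* (ℚᵘ.mkℚᵘ (+ suc m) 0) (ℚᵘ.mkℚᵘ (+ 1) (m ℕ.+ 9 ℕ.* suc m)))
  (ℚ.fromℚᵘ-cong {ℚᵘ.mkℚᵘ (+ suc m) 0 ℚᵘ.* ℚᵘ.mkℚᵘ (+ 1) (m ℕ.+ 9 ℕ.* suc m)} {ℚᵘ.mkℚᵘ (+ 1) 9}
    (ℚᵘ.*≡* cross-multiplied))
  where
  open +-*-Solver
  cross-multiplied : (+ suc m ℤ.* + 1) ℤ.* + 10 ≡ + 1 ℤ.* (+ 1 ℤ.* + (10 ℕ.* suc m))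
  cross-multiplied = trans
    (solve 1 (λ x → (x :* con (+ 1)) :* con (+ 10)
                  := con (+ 1) :* (con (+ 1) :* (con (+ 10) :* x))) refl (+ suc m))
    (cong (λ z → + 1 ℤ.* (+ 1 ℤ.* z)) (sym (ℤ.pos-* 10 (suc m))))

ℕ→ℚ-nonNeg : ∀ a → 0ℚ ≤ℚ ℕ→ℚ a
ℕ→ℚ-nonNeg a = ℚ.nonNegative⁻¹ _ {{ℚ.normalize-nonNeg a 1}}

p≤p+q : ∀ p q → 0ℚ ≤ℚ q → p ≤ℚ p + q
p≤p+q p q 0≤q = ℚ.≤-trans (ℚ.≤-reflexive (sym (ℚ.+-identityʳ p))) (ℚ.+-monoʳ-≤ p 0≤q)

ℕ→ℚ-mono-≤ : ∀ {a b} → a ≤ b → ℕ→ℚ a ≤ℚ ℕ→ℚ b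
ℕ→ℚ-mono-≤ {a} {b} a≤b = subst (λ z → ℕ→ℚ a ≤ℚ ℕ→ℚ z) (ℕ.m+[n∸m]≡n a≤b)
  (subst (ℕ→ℚ a ≤ℚ_) (sym (ℕ→ℚ-+ a (b ℕ.∸ a))) (p≤p+q _ _ (ℕ→ℚ-nonNeg (b ℕ.∸ a))))

0≤p*q : ∀ {p q} → 0ℚ ≤ℚ p → 0ℚ ≤ℚ q → 0ℚ ≤ℚ p * q
0≤p*q {p} {q} 0≤p 0≤q = ℚ.nonNegative⁻¹ _
  {{ℚ.nonNeg*nonNeg⇒nonNeg p {{ℚ.nonNegative 0≤p}} q {{ℚ.nonNegative 0≤q}}}}

0<p*q⇒0≤p : ∀ {p q} → 0ℚ ≤ℚ q → 0ℚ < p * q → 0ℚ ≤ℚ p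
0<p*q⇒0≤p {p} {q} 0≤q 0<pq with ℚ.≤-total 0ℚ p
... | inj₁ 0≤p = 0≤p
... | inj₂ p≤0 = contradiction (ℚ.<-≤-trans 0<pq pq≤0) (ℚ.<-irrefl refl)
  where
  pq≤0 : p * q ≤ℚ 0ℚ
  pq≤0 = ℚ.≤-trans (ℚ.*-monoʳ-≤-nonNeg q {{ℚ.nonNegative 0≤q}} p≤0) (ℚ.≤-reflexive (ℚ.*-zeroˡ q))

Σℚ-cong : ∀ k {f g : Fin k → ℚ} → (∀ j → f j ≡ g j) → Σℚ k f ≡ Σℚ k g
Σℚ-cong zero    f≡g = refl
Σℚ-cong (suc k) f≡g = cong₂ _+_ (f≡g Fin.zero) (Σℚ-cong k (f≡g ∘ Fin.suc))

Σℚ-mono-≤ : ∀ k {f g : Fin k → ℚ} → (∀ j → f j ≤ℚ g j) → Σℚ k f ≤ℚ Σℚ k g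
Σℚ-mono-≤ zero    f≤g = ℚ.≤-refl
Σℚ-mono-≤ (suc k) f≤g = ℚ.+-mono-≤ (f≤g Fin.zero) (Σℚ-mono-≤ k (f≤g ∘ Fin.suc))

Σℚ-nonNeg : ∀ k (f : Fin k → ℚ) → (∀ j → 0ℚ ≤ℚ f j) → 0ℚ ≤ℚ Σℚ k f
Σℚ-nonNeg k f 0≤f = subst (_≤ℚ Σℚ k f) (Σℚ-zero k) (Σℚ-mono-≤ k 0≤f)
  where
  Σℚ-zero : ∀ k → Σℚ k (λ _ → 0ℚ) ≡ 0ℚ
  Σℚ-zero zero    = refl
  Σℚ-zero (suc k) = trans (cong (_+_ 0ℚ) (Σℚ-zero k)) (ℚ.+-identityˡ 0ℚ)

Σℚ-≤-* : ∀ k (f : Fin k → ℚ) B → (∀ j → f j ≤ℚ B) → Σℚ k f ≤ℚ ℕ→ℚ k * B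
Σℚ-≤-* zero    f B f≤B = ℚ.≤-reflexive (sym (ℚ.*-zeroˡ B))
Σℚ-≤-* (suc k) f B f≤B = begin
  f Fin.zero + Σℚ k (f ∘ Fin.suc) ≤⟨ ℚ.+-mono-≤ (f≤B Fin.zero) (Σℚ-≤-* k (f ∘ Fin.suc) B (f≤B ∘ Fin.suc)) ⟩
  B + ℕ→ℚ k * B                   ≡⟨ solve 2 (λ b K → b :+ K :* b := (con 1ℚ :+ K) :* b) refl B (ℕ→ℚ k) ⟩
  (1ℚ + ℕ→ℚ k) * B                ≡⟨ cong (_* B) (sym (ℕ→ℚ-+ 1 k)) ⟩
  ℕ→ℚ (suc k) * B                 ∎
  where
  open ℚ.≤-Reasoning
  open ℚ-Solver

Σℚ-*ʳ : ∀ k (f : Fin k → ℚ) x → Σℚ k (λ j → f j * x) ≡ Σℚ k f * x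
Σℚ-*ʳ zero    f x = sym (ℚ.*-zeroˡ x)
Σℚ-*ʳ (suc k) f x = trans (cong (_+_ (f Fin.zero * x)) (Σℚ-*ʳ k (f ∘ Fin.suc) x))
  (sym (ℚ.*-distribʳ-+ x (f Fin.zero) (Σℚ k (f ∘ Fin.suc))))

Σℚ-+ : ∀ k (f g : Fin k → ℚ) → Σℚ k (λ j → f j + g j) ≡ Σℚ k f + Σℚ k g
Σℚ-+ zero    f g = sym (ℚ.+-identityˡ 0ℚ)
Σℚ-+ (suc k) f g = trans (cong (_+_ (f Fin.zero + g Fin.zero)) (Σℚ-+ k (f ∘ Fin.suc) (g ∘ Fin.suc)))
  (solve 4 (λ a b c d → (a :+ b) :+ (c :+ d) := (a :+ c) :+ (b :+ d)) refl
     (f Fin.zero) (g Fin.zero) (Σℚ k (f ∘ Fin.suc)) (Σℚ k (g ∘ Fin.suc)))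
  where open ℚ-Solver

module _ {k : ℕ} {P : Fin k → ℚ} (ΣP≡1 : Σℚ k P ≡ 1ℚ) where

  Σℚ-*-const : ∀ x → Σℚ k (λ j → P j * x) ≡ x
  Σℚ-*-const x = trans (Σℚ-*ʳ k P x) (trans (cong (_* x) ΣP≡1) (ℚ.*-identityˡ x))

  Σℚ-*-+-const : ∀ (f : Fin k → ℚ) x →
                 Σℚ k (λ j → P j * (f j + x)) ≡ Σℚ k (λ j → P j * f j) + x
  Σℚ-*-+-const f x = begin
    Σℚ k (λ j → P j * (f j + x))                      ≡⟨ Σℚ-cong k (λ j → ℚ.*-distribˡ-+ (P j) (f j) x) ⟩
    Σℚ k (λ j → P j * f j + P j * x)                  ≡⟨ Σℚ-+ k _ _ ⟩
    Σℚ k (λ j → P j * f j) + Σℚ k (λ j → P j * x)    ≡⟨ cong (_+_ (Σℚ k (λ j → P j * f j))) (Σℚ-*-const x) ⟩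
    Σℚ k (λ j → P j * f j) + x                        ∎
    where open ≡-Reasoning

module _ {m : ℕ} where

  count : Fin m → List (Fin m) → ℕ
  count q []      = 0
  count q (p ∷ L) with q ≟ p
  ... | yes _ = suc (count q L)
  ... | no  _ = count q L

  count-∷-≡ : ∀ {q p} L → q ≡ p → count q (p ∷ L) ≡ suc (count q L)
  count-∷-≡ {q} {p} L q≡p with q ≟ p
  ... | yes _   = refl
  ... | no  q≢p = contradiction q≡p q≢p

  count-∷-≢ : ∀ {q p} L → q ≢ p → count q (p ∷ L) ≡ count q L
  count-∷-≢ {q} {p} L q≢p with q ≟ p
  ... | yes q≡p = contradiction q≡p q≢p
  ... | no  _   = refl

  count-∷-≥ : ∀ q p L → count q L ≤ count q (p ∷ L)
  count-∷-≥ q p L with q ≟ p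
  ... | yes _ = ℕ.n≤1+n _
  ... | no  _ = ℕ.≤-refl

  count-++ : ∀ q xs ys → count q (xs ++ ys) ≡ count q xs ℕ.+ count q ys
  count-++ q []       ys = refl
  count-++ q (x ∷ xs) ys with q ≟ x
  ... | yes _ = cong suc (count-++ q xs ys)
  ... | no  _ = count-++ q xs ys

  count-replicate-≡ : ∀ q k → count q (replicate k q) ≡ k
  count-replicate-≡ q zero    = refl
  count-replicate-≡ q (suc k) = trans (count-∷-≡ (replicate k q) refl) (cong suc (count-replicate-≡ q k))

  count-replicate-≢ : ∀ {q p} k → q ≢ p → count q (replicate k p) ≡ 0
  count-replicate-≢ zero    q≢p = refl
  count-replicate-≢ (suc k) q≢p = trans (count-∷-≢ _ q≢p) (count-replicate-≢ k q≢p)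

  bump-count : ∀ (cnt : Fin m → ℕ) p q L → bump p cnt q ℕ.+ count q L ≡ cnt q ℕ.+ count q (p ∷ L)
  bump-count cnt p q L with q ≟ p
  ... | yes _ = sym (ℕ.+-suc (cnt q) (count q L))
  ... | no  _ = refl

  costs : (Fin m → ℚ) → List (Fin m) → ℚ
  costs c []      = 0ℚ
  costs c (p ∷ L) = c p + costs c L

  costs-++ : ∀ c xs ys → costs c (xs ++ ys) ≡ costs c xs + costs c ys
  costs-++ c []       ys = sym (ℚ.+-identityˡ _)
  costs-++ c (x ∷ xs) ys = trans (cong (_+_ (c x)) (costs-++ c xs ys)) (sym (ℚ.+-assoc (c x) _ _))

  costs-replicate : ∀ c k p → costs c (replicate k p) ≡ ℕ→ℚ k * c p
  costs-replicate c zero    p = sym (ℚ.*-zeroˡ (c p))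
  costs-replicate c (suc k) p = begin
    c p + costs c (replicate k p) ≡⟨ cong (_+_ (c p)) (costs-replicate c k p) ⟩
    c p + ℕ→ℚ k * c p             ≡⟨ solve 2 (λ x K → x :+ K :* x := (con 1ℚ :+ K) :* x) refl (c p) (ℕ→ℚ k) ⟩
    (1ℚ + ℕ→ℚ k) * c p            ≡⟨ cong (_* c p) (sym (ℕ→ℚ-+ 1 k)) ⟩
    ℕ→ℚ (suc k) * c p             ∎
    where
    open ≡-Reasoning
    open ℚ-Solver

count-map-suc-zero : ∀ {m} (L : List (Fin m)) → count Fin.zero (map Fin.suc L) ≡ 0
count-map-suc-zero []      = refl
count-map-suc-zero (x ∷ L) = count-map-suc-zero L

count-map-suc : ∀ {m} (q : Fin m) L → count (Fin.suc q) (map Fin.suc L) ≡ count q L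
count-map-suc q []      = refl
count-map-suc q (x ∷ L) with q ≟ x
... | yes _ = cong suc (count-map-suc q L)
... | no  _ = count-map-suc q L

costs-map-suc : ∀ {m} (c : Fin (suc m) → ℚ) L → costs c (map Fin.suc L) ≡ costs (c ∘ Fin.suc) L
costs-map-suc c []      = refl
costs-map-suc c (x ∷ L) = cong (_+_ (c (Fin.suc x))) (costs-map-suc c L)

copies : (m : ℕ) → (Fin m → ℕ) → List (Fin m)
copies zero    k = []
copies (suc m) k = replicate (k Fin.zero) Fin.zero ++ map Fin.suc (copies m (k ∘ Fin.suc))

count-copies : ∀ m k (q : Fin m) → count q (copies m k) ≡ k q
count-copies (suc m) k q = trans (count-++ q zeros rest) (at q)
  where
  zeros rest : List (Fin (suc m))
  zeros = replicate (k Fin.zero) Fin.zero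
  rest  = map Fin.suc (copies m (k ∘ Fin.suc))
  at : ∀ q → count q zeros ℕ.+ count q rest ≡ k q
  at Fin.zero = begin
    count Fin.zero zeros ℕ.+ count Fin.zero rest ≡⟨ cong₂ ℕ._+_ (count-replicate-≡ Fin.zero (k Fin.zero)) (count-map-suc-zero (copies m (k ∘ Fin.suc))) ⟩
    k Fin.zero ℕ.+ 0                            ≡⟨ ℕ.+-identityʳ _ ⟩
    k Fin.zero                                  ∎
    where open ≡-Reasoning
  at (Fin.suc q) = begin
    count (Fin.suc q) zeros ℕ.+ count (Fin.suc q) rest ≡⟨ cong₂ ℕ._+_ (count-replicate-≢ (k Fin.zero) (λ ())) (count-map-suc q (copies m (k ∘ Fin.suc))) ⟩
    count q (copies m (k ∘ Fin.suc))                  ≡⟨ count-copies m (k ∘ Fin.suc) q ⟩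
    k (Fin.suc q)                                     ∎
    where open ≡-Reasoning

costs-copies : ∀ m (c : Fin m → ℚ) k → costs c (copies m k) ≡ Σℚ m (λ q → ℕ→ℚ (k q) * c q)
costs-copies zero    c k = refl
costs-copies (suc m) c k = begin
  costs c (zeros ++ rest)       ≡⟨ costs-++ c zeros rest ⟩
  costs c zeros + costs c rest  ≡⟨ cong₂ _+_ (costs-replicate c (k Fin.zero) Fin.zero)
                                             (trans (costs-map-suc c (copies m (k ∘ Fin.suc)))
                                                    (costs-copies m (c ∘ Fin.suc) (k ∘ Fin.suc))) ⟩
  ℕ→ℚ (k Fin.zero) * c Fin.zero + Σℚ m (λ q → ℕ→ℚ (k (Fin.suc q)) * c (Fin.suc q)) ∎
  where
  open ≡-Reasoning
  zeros rest : List (Fin (suc m))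
  zeros = replicate (k Fin.zero) Fin.zero
  rest  = map Fin.suc (copies m (k ∘ Fin.suc))

round-up : ∀ d a → 1 ≤ d → Σ ℕ (λ k → k ℕ.< d × d ∣ a ℕ.+ k)
round-up (suc d) zero    _ = 0 , s≤s z≤n , (suc d ∣0)
round-up (suc d) (suc a) 1≤d with round-up (suc d) a 1≤d
... | zero , _ , d∣a+0 = d , ℕ.≤-refl ,
      subst (suc d ∣_) (ℕ.+-suc a d) (∣m∣n⇒∣m+n (subst (suc d ∣_) (ℕ.+-identityʳ a) d∣a+0) ∣-refl)
... | suc k , k<d , d∣a+k = k , ℕ.<-trans (ℕ.n<1+n k) k<d , subst (suc d ∣_) (ℕ.+-suc a k) d∣a+k

insertAll : {n W : ℕ} → List (Fin n) → Strategy n W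
insertAll []      = stop
insertAll (p ∷ L) = insert p (λ _ → insertAll L)

insertAll-cost : ∀ {n W} (c : Fin n → ℚ) (P : Fin n → Fin W → ℚ) → (∀ i → Σℚ W (P i) ≡ 1ℚ) →
                 ∀ L → cost c P (insertAll L) ≡ costs c L
insertAll-cost c P ΣP≡1 []      = refl
insertAll-cost c P ΣP≡1 (p ∷ L) =
  cong (_+_ (c p)) (trans (Σℚ-*-const {P = P p} (ΣP≡1 p) (cost c P (insertAll L))) (insertAll-cost c P ΣP≡1 L))

-- Each count stays below its period, so every insertion still hits a count
-- that is not yet a multiple, as RValid demands once the weight has reached W.
insertAll-rvalid : ∀ {n W} (e : Fin n → ℕ) L w cnt → W ≤ w →
                   (∀ q → e q ∣ cnt q ℕ.+ count q L) → (∀ q → count q L ℕ.< e q) →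
                   RValid {n} {W} e w cnt (insertAll L)
insertAll-rvalid e []      w cnt W≤w divides _ =
  stop-ok W≤w (λ q → subst (e q ∣_) (ℕ.+-identityʳ (cnt q)) (divides q))
insertAll-rvalid e (p ∷ L) w cnt W≤w divides below =
  insert-ok (λ _ → p-pending)
    (λ j → insertAll-rvalid e L (w ℕ.+ weight j) (bump p cnt) (ℕ.≤-trans W≤w (ℕ.m≤m+n w (weight j)))
             (λ q → subst (e q ∣_) (sym (bump-count cnt p q L)) (divides q))
             (λ q → ℕ.≤-<-trans (count-∷-≥ q p L) (below q)))
  where
  p-pending : ¬ (e p ∣ cnt p)
  p-pending e∣cnt = ℕ.<⇒≱ (subst (ℕ._< e p) (count-∷-≡ L refl) (below p)) (∣⇒≤ rest)
    where
    rest : e p ∣ suc (count p L)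
    rest = ∣m+n∣m⇒∣n (subst (λ z → e p ∣ cnt p ℕ.+ z) (count-∷-≡ L refl) (divides p)) e∣cnt

module Restrict {n W : ℕ} (e : Fin n → ℕ) (e≥1 : ∀ q → 1 ≤ e q) where

  missing : (Fin n → ℕ) → Fin n → ℕ
  missing cnt q = proj₁ (round-up (e q) (cnt q) (e≥1 q))

  missing<e : ∀ cnt q → missing cnt q ℕ.< e q
  missing<e cnt q = proj₁ (proj₂ (round-up (e q) (cnt q) (e≥1 q)))

  padding : (Fin n → ℕ) → Strategy n W
  padding cnt = insertAll (copies n (missing cnt))

  restrict : Strategy n W → (Fin n → ℕ) → Strategy n W
  restrict stop         cnt = padding cnt
  restrict (insert i k) cnt = insert i (λ j → restrict (k j) (bump i cnt))

  restrict-rvalid : ∀ S w cnt → Valid w S → RValid e w cnt (restrict S cnt)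
  restrict-rvalid stop w cnt (stop-ok W≤w) =
    insertAll-rvalid e (copies n (missing cnt)) w cnt W≤w
      (λ q → subst (λ z → e q ∣ cnt q ℕ.+ z) (sym (count-copies n _ q))
                   (proj₂ (proj₂ (round-up (e q) (cnt q) (e≥1 q)))))
      (λ q → subst (ℕ._< e q) (sym (count-copies n _ q)) (missing<e cnt q))
  restrict-rvalid (insert i k) w cnt (insert-ok w<W valid) =
    insert-ok (λ W≤w _ → ℕ.<⇒≱ w<W W≤w) (λ j → restrict-rvalid (k j) _ _ (valid j))

  restrict-cost : (c : Fin n → ℚ) (P : Fin n → Fin W → ℚ) → (∀ i → IsDistribution W (P i)) →
                  (B : ℚ) → (∀ cnt → cost c P (padding cnt) ≤ℚ B) →
                  ∀ S cnt → cost c P (restrict S cnt) ≤ℚ cost c P S + B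
  restrict-cost c P dist B pad≤B stop cnt = ℚ.≤-trans (pad≤B cnt) (ℚ.≤-reflexive (sym (ℚ.+-identityˡ B)))
  restrict-cost c P dist B pad≤B (insert i k) cnt = begin
    c i + Σℚ W (λ j → P i j * cost c P (restrict (k j) (bump i cnt)))
      ≤⟨ ℚ.+-monoʳ-≤ (c i) (Σℚ-mono-≤ W (λ j →
           ℚ.*-monoˡ-≤-nonNeg (P i j) {{ℚ.nonNegative (proj₁ (dist i) j)}}
             (restrict-cost c P dist B pad≤B (k j) (bump i cnt)))) ⟩
    c i + Σℚ W (λ j → P i j * (cost c P (k j) + B))
      ≡⟨ cong (_+_ (c i)) (Σℚ-*-+-const (proj₂ (dist i)) (λ j → cost c P (k j)) B) ⟩
    c i + (Σℚ W (λ j → P i j * cost c P (k j)) + B)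
      ≡⟨ sym (ℚ.+-assoc (c i) _ B) ⟩
    c i + Σℚ W (λ j → P i j * cost c P (k j)) + B
      ∎
    where open ℚ.≤-Reasoning

Ebar-nonNeg : ∀ W (P : Fin W → ℚ) → (∀ j → 0ℚ ≤ℚ P j) → 0ℚ ≤ℚ Ebar W P
Ebar-nonNeg W P 0≤P = Σℚ-nonNeg W _ (λ j → 0≤p*q (0≤P j) (ℕ→ℚ-nonNeg (2 ℕ.^ ⌊log₂ weight j ⌋)))

T-nonNeg : ∀ {n} W → 1 ≤ W → (c : Fin n → ℚ) → (∀ i → 0ℚ < c i) →
           (P : Fin n → Fin W → ℚ) → (∀ i → IsDistribution W (P i)) →
           ∀ T → IsT n W c P T → 0ℚ ≤ℚ T
T-nonNeg (suc w) _ c 0<c P dist T (_ , i , T*E≡W/2*c) =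
  0<p*q⇒0≤p (Ebar-nonNeg (suc w) (P i) (proj₁ (dist i))) (subst (0ℚ <_) (sym T*E≡W/2*c) 0<W/2*c)
  where
  0<W/2*c : 0ℚ < (+ suc w / 2) * c i
  0<W/2*c = ℚ.positive⁻¹ _ {{ℚ.pos*pos⇒pos (+ suc w / 2) {{ℚ.normalize-pos (suc w) 2}} (c i) {{ℚ.positive (0<c i)}}}}

theta-nonNeg : ∀ m ε → 0ℚ < ε → 0ℚ ≤ℚ theta ε (suc m)
theta-nonNeg m ε 0<ε = 0≤p*q (ℚ.<⇒≤ 0<ε) (ℚ.nonNegative⁻¹ _ {{ℚ.normalize-nonNeg 1 (10 ℕ.* suc m)}})

module _ {n} (c : Fin n → ℚ) (θT : ℚ) (e : Fin n → ℕ) (isE : IsE n c θT e) where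

  e≥1 : ∀ q → 1 ≤ e q
  e≥1 q with θT ℚ.≤? c q
  ... | yes θT≤c = subst (1 ≤_) (sym (proj₁ (isE q) θT≤c)) ℕ.≤-refl
  ... | no  θT≰c with proj₂ (isE q) (ℚ.≰⇒> θT≰c)
  ...   | k , e≡2^k , _ = subst (1 ≤_) (sym e≡2^k) (ℕ.m^n>0 2 k)

  below-e-cost : (∀ i → 0ℚ < c i) → 0ℚ ≤ℚ θT → ∀ q k → k ℕ.< e q → ℕ→ℚ k * c q ≤ℚ ℕ→ℚ 2 * θT
  below-e-cost 0<c 0≤θT q k k<e with θT ℚ.≤? c q
  ... | yes θT≤c rewrite ℕ.n<1⇒n≡0 (subst (k ℕ.<_) (proj₁ (isE q) θT≤c) k<e) =
    ℚ.≤-trans (ℚ.≤-reflexive (ℚ.*-zeroˡ (c q))) (0≤p*q (ℕ→ℚ-nonNeg 2) 0≤θT)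
  ... | no  θT≰c with proj₂ (isE q) (ℚ.≰⇒> θT≰c)
  ...   | _ , _ , _ , e*c≤2θT =
    ℚ.≤-trans (ℚ.*-monoʳ-≤-nonNeg (c q) {{ℚ.nonNegative (ℚ.<⇒≤ (0<c q))}} (ℕ→ℚ-mono-≤ (ℕ.<⇒≤ k<e))) e*c≤2θT

n*2θT≡εT/5 : ∀ m ε T → ℕ→ℚ (suc m) * (ℕ→ℚ 2 * (theta ε (suc m) * T)) ≡ ε * T * (+ 1 / 5)
n*2θT≡εT/5 m ε T =
  trans (solve 5 (λ N two a u t → N :* (two :* (a :* u :* t)) := a :* t :* (two :* (N :* u))) refl
           (ℕ→ℚ (suc m)) (ℕ→ℚ 2) ε (+ 1 / (10 ℕ.* suc m)) T)
        (cong (λ z → ε * T * (ℕ→ℚ 2 * z)) (n*1/[10n]≡1/10 m))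
  where open ℚ-Solver

lemma4 : (n W : ℕ) → 1 ≤ n → 1 ≤ W → (ε : ℚ) → 0ℚ < ε → ε < 1ℚ →
    (c : Fin n → ℚ) → ((i : Fin n) → 0ℚ < c i) →
    (P : Fin n → Fin W → ℚ) → ((i : Fin n) → IsDistribution W (P i)) →
    (T : ℚ) → IsT n W c P T →
    (e : Fin n → ℕ) → IsE n c (theta ε n * T) e →
    (S : Strategy n W) → Valid 0 S →
    Σ (Strategy n W) (λ R → RValid e 0 (λ _ → 0) R ×
    cost c P R ≤ℚ cost c P S + ε * T * (+ 1 / 5))
lemma4 (suc m) W _ 1≤W ε 0<ε _ c 0<c P dist T isT e isE S valid =
  restrict S (λ _ → 0) ,
  restrict-rvalid S 0 (λ _ → 0) valid ,
  restrict-cost c P dist (ε * T * (+ 1 / 5)) padding≤εT/5 S (λ _ → 0)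
  where
  θT : ℚ
  θT = theta ε (suc m) * T
  open Restrict {suc m} {W} e (e≥1 c θT e isE)
  0≤θT : 0ℚ ≤ℚ θT
  0≤θT = 0≤p*q (theta-nonNeg m ε 0<ε) (T-nonNeg W 1≤W c 0<c P dist T isT)
  padding≤εT/5 : ∀ cnt → cost c P (padding cnt) ≤ℚ ε * T * (+ 1 / 5)
  padding≤εT/5 cnt = begin
    cost c P (padding cnt)                                  ≡⟨ insertAll-cost c P (proj₂ ∘ dist) (copies (suc m) (missing cnt)) ⟩
    costs c (copies (suc m) (missing cnt))                  ≡⟨ costs-copies (suc m) c (missing cnt) ⟩
    Σℚ (suc m) (λ q → ℕ→ℚ (missing cnt q) * c q)            ≤⟨ Σℚ-≤-* (suc m) _ _ (λ q → below-e-cost c θT e isE 0<c 0≤θT q _ (missing<e cnt q)) ⟩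
    ℕ→ℚ (suc m) * (ℕ→ℚ 2 * θT)                              ≡⟨ n*2θT≡εT/5 m ε T ⟩
    ε * T * (+ 1 / 5)                                       ∎
    where open ℚ.≤-Reasoning
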